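{- Every forest is a Zykov graph.
   Context: Zykov's construction: $Z_1$ is the graph with one vertex. Given $Z_1,\dots,Z_k$ ($k\ge 1$), the graph $Z_{k+1}$ is obtained by taking the disjoint union of $Z_1,\dots,Z_k$ and, for each $k$-tuple $(v_1,\dots,v_k)$ with $v_i\in V(Z_i)$, adding a new vertex adjacent exactly to $v_1,\dots,v_k$. A Zykov graph is any graph isomorphic to an induced subgraph of $Z_k$ for some integer $k\ge 1$. -}

module Defs where

open import Data.Nat using (ℕ; zero; suc; _+_)
open import Data.Fin using (Fin; zero; suc; toℕ; inject₁; fromℕ)
open import Data.Bool using (Bool; true; false; T)
open import Data.Product using (Σ; ∃; _×_; _,_)
open import Relation.Binary.PropositionalEquality using (_≡_)
open import Relation.Nullary using (¬_)
open import Function.Definitions using (Injective)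

record Graph : Set where
  field
    n     : ℕ
    adj   : Fin n → Fin n → Bool
    sym   : ∀ u v → adj u v ≡ adj v u
    irrefl : ∀ u → adj u u ≡ false

  Edge : Fin n → Fin n → Set
  Edge u v = T (adj u v)

open Graph public

record Cycle (G : Graph) : Set where
  field
    len    : ℕ
    vtx    : Fin (3 + len) → Fin (n G)
    inj    : Injective _≡_ _≡_ vtx
    step   : ∀ (i : Fin (2 + len)) → Edge G (vtx (inject₁ i)) (vtx (suc i))
    close  : Edge G (vtx (fromℕ (2 + len))) (vtx zero)

Forest : Graph → Set
Forest G = ¬ Cycle G

-- ZV k is the vertex set of Z_{k+1}:
--   old j x : the vertex x of the copy of Z_{j+1} (j < k),
--   new t   : the new vertex for the k-tuple t (t j ∈ V(Z_{j+1})).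
-- For k = 0 there is exactly one vertex (new of the empty tuple), so
-- ZV 0 is the one-vertex graph Z_1.

data ZV : ℕ → Set where
  old : ∀ {k} (j : Fin k) → ZV (toℕ j) → ZV k
  new : ∀ {k} → ((j : Fin k) → ZV (toℕ j)) → ZV k

data ZAdj : ∀ {k} → ZV k → ZV k → Set where
  inside : ∀ {k} (j : Fin k) {x y : ZV (toℕ j)} →
           ZAdj x y → ZAdj {k} (old j x) (old j y)
  up     : ∀ {k} (t : (j : Fin k) → ZV (toℕ j)) (j : Fin k) →
           ZAdj (new t) (old j (t j))
  down   : ∀ {k} (t : (j : Fin k) → ZV (toℕ j)) (j : Fin k) →
           ZAdj (old j (t j)) (new t)

ZykovGraph : Graph → Set
ZykovGraph G =
  Σ ℕ λ k → Σ (Fin (n G) → ZV k) λ f →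
    Injective _≡_ _≡_ f ×
    (∀ u v → (Edge G u v → ZAdj (f u) (f v)) × (ZAdj (f u) (f v) → Edge G u v))

-- A forest on n + 1 vertices has a vertex of degree at most 1 (otherwise a
-- non-backtracking walk eventually closes up into a cycle).  Deleting it and
-- embedding the rest into Z_{k+1} by induction, push that embedding into the
-- last copy of Z_{k+1} inside Z_{k+2}: the new vertex of Z_{k+2} whose tuple
-- ends in the image of the unique neighbour is adjacent, within that copy,
-- to exactly that image, so it can host a leaf.  An isolated vertex is hosted
-- one level higher by the copy of Z_1 inside Z_{k+3}.
module Submission where

open import Defs
open import Data.Nat using (ℕ; zero; suc; _+_; _<_; _≤_; s≤s)
open import Data.Nat.Properties using (<-cmp; +-comm; +-monoˡ-<; +-monoˡ-≤; m≤n⇒∃[o]m+o≡n; n<1+n; ≤-pred)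
open import Data.Fin using (Fin; zero; suc; toℕ; fromℕ; fromℕ<; inject₁; punchIn; punchOut; _≟_)
open import Data.Fin.Properties using (toℕ-injective; toℕ<n; toℕ-fromℕ; toℕ-fromℕ<; toℕ-inject; toℕ-inject₁; punchIn-injective; punchIn-punchOut; all?; any?; ¬∀⟶∃¬; ¬∀⟶∃¬-smallest; pigeonhole)
open import Data.Fin.Relation.Unary.Top using (View; ‵fromℕ; ‵inj₁; view; view-fromℕ)
open import Data.Vec.Functional using (insertAt)
open import Data.Vec.Functional.Properties using (insertAt-lookup; insertAt-punchIn)
open import Data.Bool using (T)
open import Data.Empty using (⊥; ⊥-elim)
open import Data.Product using (∃; _×_; _,_; proj₁; proj₂)
open import Data.Sum using (_⊎_; inj₁; inj₂; [_,_]′)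
open import Function using (_∘_; id)
open import Function.Bundles using (_⇔_; mk⇔; Equivalence)
open import Function.Definitions using (Injective)
open import Relation.Binary.Definitions using (Symmetric; tri<; tri≈; tri>)
open import Relation.Binary.PropositionalEquality using (_≡_; _≢_; refl; cong; subst; subst₂; trans) renaming (sym to ≡-sym)
open import Relation.Nullary using (¬_; Dec; yes; no)
open import Relation.Nullary.Decidable using (T?; ¬?; _×-dec_; decidable-stable)

open Equivalence using (to; from)

record Embedding {A B : Set} (R : A → A → Set) (S : B → B → Set) : Set where
  field
    map       : A → B
    injective : Injective _≡_ _≡_ map
    preserves : ∀ {x y} → R x y → S (map x) (map y)
    reflects  : ∀ {x y} → S (map x) (map y) → R x y
open Embedding

idᴱ : ∀ {A} {R : A → A → Set} → Embedding R R
idᴱ = record { map = id ; injective = id ; preserves = id ; reflects = id }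

_∘ᴱ_ : ∀ {A B C} {R : A → A → Set} {S : B → B → Set} {U : C → C → Set} →
       Embedding S U → Embedding R S → Embedding R U
g ∘ᴱ f = record
  { map       = map g ∘ map f
  ; injective = injective f ∘ injective g
  ; preserves = preserves g ∘ preserves f
  ; reflects  = reflects f ∘ reflects g
  }

record FreshVertex {A B : Set} {R : A → A → Set} {S : B → B → Set}
                   (f : Embedding R S) (N : A → Set) : Set where
  field
    vertex     : B
    fresh      : ∀ x → vertex ≢ map f x
    neighbours : ∀ x → S vertex (map f x) ⇔ N x
open FreshVertex

freshVertex-∘ : ∀ {A B C} {R : A → A → Set} {S : B → B → Set} {U : C → C → Set}
                {g : Embedding S U} {N : B → Set} {P : A → Set} →
                (f : Embedding R S) → FreshVertex g N → (∀ x → N (map f x) ⇔ P x) →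
                FreshVertex (g ∘ᴱ f) P
freshVertex-∘ f X N⇔P = record
  { vertex     = vertex X
  ; fresh      = fresh X ∘ map f
  ; neighbours = λ x → mk⇔ (to (N⇔P x) ∘ to (neighbours X (map f x)))
                           (from (neighbours X (map f x)) ∘ from (N⇔P x))
  }

data PunchInView {m} (v : Fin (suc m)) : Fin (suc m) → Set where
  at     : PunchInView v v
  beside : (x : Fin m) → PunchInView v (punchIn v x)

punchInView : ∀ {m} (v w : Fin (suc m)) → PunchInView v w
punchInView v w with v ≟ w
... | yes refl = at
... | no v≢w   = subst (PunchInView v) (punchIn-punchOut v≢w) (beside (punchOut v≢w))

module _ {m} {B : Set} {R : Fin (suc m) → Fin (suc m) → Set} {S : B → B → Set}
         (R-sym : Symmetric R) (S-sym : Symmetric S)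
         (R-irrefl : ∀ {x} → ¬ R x x) (S-irrefl : ∀ {b} → ¬ S b b) where

  extend : (v : Fin (suc m)) (f : Embedding (λ x y → R (punchIn v x) (punchIn v y)) S) →
           FreshVertex f (R v ∘ punchIn v) → Embedding R S
  extend v f X = record
    { map       = F
    ; injective = F-injective
    ; preserves = λ {w} {w'} → to (F-⇔ w w')
    ; reflects  = λ {w} {w'} → from (F-⇔ w w')
    }
    where
    F : Fin (suc m) → B
    F = insertAt (map f) v (vertex X)

    F-at : F v ≡ vertex X
    F-at = insertAt-lookup (map f) v (vertex X)

    F-beside : ∀ x → F (punchIn v x) ≡ map f x
    F-beside x = insertAt-punchIn (map f) v (vertex X) x

    F-injective : Injective _≡_ _≡_ F
    F-injective {w} {w'} eq with punchInView v w | punchInView v w'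
    ... | at       | at       = refl
    ... | at       | beside y = ⊥-elim (fresh X y (trans (≡-sym F-at) (trans eq (F-beside y))))
    ... | beside x | at       = ⊥-elim (fresh X x (trans (≡-sym F-at) (trans (≡-sym eq) (F-beside x))))
    ... | beside x | beside y =
      cong (punchIn v) (injective f (trans (≡-sym (F-beside x)) (trans eq (F-beside y))))

    F-⇔ : ∀ w w' → R w w' ⇔ S (F w) (F w')
    F-⇔ w w' with punchInView v w | punchInView v w'
    ... | at       | at       rewrite F-at = mk⇔ (⊥-elim ∘ R-irrefl) (⊥-elim ∘ S-irrefl)
    ... | at       | beside y rewrite F-at | F-beside y =
      mk⇔ (from (neighbours X y)) (to (neighbours X y))
    ... | beside x | at       rewrite F-at | F-beside x =
      mk⇔ (S-sym ∘ from (neighbours X x) ∘ R-sym) (R-sym ∘ to (neighbours X x) ∘ S-sym)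
    ... | beside x | beside y rewrite F-beside x | F-beside y = mk⇔ (preserves f) (reflects f)

ZAdj-sym : ∀ {k} → Symmetric (ZAdj {k})
ZAdj-sym (inside j a) = inside j (ZAdj-sym a)
ZAdj-sym (up t j)     = down t j
ZAdj-sym (down t j)   = up t j

ZAdj-irrefl : ∀ {k} {x : ZV k} → ¬ ZAdj x x
ZAdj-irrefl (inside j a) = ZAdj-irrefl a

up⁻¹ : ∀ {k} {t : (j : Fin k) → ZV (toℕ j)} {j : Fin k} {y : ZV (toℕ j)} →
       ZAdj (new t) (old j y) → y ≡ t j
up⁻¹ (up _ _) = refl

someVertex : ∀ k → ZV k
someVertex zero    = new (λ ())
someVertex (suc k) = old zero (someVertex zero)

copy : ∀ {k} (j : Fin k) → Embedding (ZAdj {toℕ j}) (ZAdj {k})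
copy j = record
  { map       = old j
  ; injective = λ { refl → refl }
  ; preserves = inside j
  ; reflects  = λ { (inside _ a) → a }
  }

cast : ∀ {k k'} → k ≡ k' → Embedding (ZAdj {k}) (ZAdj {k'})
cast refl = idᴱ

lastCopy : ∀ k → Embedding (ZAdj {k}) (ZAdj {suc k})
lastCopy k = copy (fromℕ k) ∘ᴱ cast (≡-sym (toℕ-fromℕ k))

freshIsolated : ∀ k → FreshVertex (lastCopy (suc k) ∘ᴱ lastCopy k) (λ _ → ⊥)
freshIsolated k = record
  { vertex     = old zero (someVertex 0)
  ; fresh      = λ _ ()
  ; neighbours = λ _ → mk⇔ (λ ()) (λ ())
  }

freshPendant : ∀ k (y : ZV k) → FreshVertex (lastCopy k) (_≡ y)
freshPendant k y = record
  { vertex     = new tuple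
  ; fresh      = λ _ ()
  ; neighbours = λ _ → mk⇔
      (λ a → injective (cast k≡last) (trans (up⁻¹ a) tuple-last))
      (λ { refl → subst (ZAdj (new tuple) ∘ old (fromℕ k)) tuple-last (up tuple (fromℕ k)) })
  }
  where
  k≡last : k ≡ toℕ (fromℕ k)
  k≡last = ≡-sym (toℕ-fromℕ k)

  entry : ∀ {j : Fin (suc k)} → View j → ZV (toℕ j)
  entry ‵fromℕ    = map (cast k≡last) y
  entry (‵inj₁ _) = someVertex _

  tuple : (j : Fin (suc k)) → ZV (toℕ j)
  tuple j = entry (view j)

  tuple-last : tuple (fromℕ k) ≡ map (cast k≡last) y
  tuple-last = cong entry (view-fromℕ k)

Edge-irrefl : (G : Graph) {u : Fin (n G)} → ¬ Edge G u u
Edge-irrefl G {u} e = subst T (irrefl G u) e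

Edge-sym : (G : Graph) → Symmetric (Edge G)
Edge-sym G {u} {v} = subst T (sym G u v)

induced : (G : Graph) {m : ℕ} → (Fin m → Fin (n G)) → Graph
induced G ι = record
  { n      = _
  ; adj    = λ x y → adj G (ι x) (ι y)
  ; sym    = λ x y → sym G (ι x) (ι y)
  ; irrefl = λ x → irrefl G (ι x)
  }

induced-forest : (G : Graph) {m : ℕ} {ι : Fin m → Fin (n G)} →
                 Injective _≡_ _≡_ ι → Forest G → Forest (induced G ι)
induced-forest G {ι = ι} ι-inj forest C = forest record
  { len   = Cycle.len C
  ; vtx   = ι ∘ Cycle.vtx C
  ; inj   = Cycle.inj C ∘ ι-inj
  ; step  = Cycle.step C
  ; close = Cycle.close C
  }

Degree≤1 : (G : Graph) → Fin (n G) → Set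
Degree≤1 G v = ∃ λ p → ∀ w → Edge G v w → w ≡ p

MinDegree≥2 : Graph → Set
MinDegree≥2 G = ∀ v p → ∃ λ w → Edge G v w × w ≢ p

neighbourBesides? : (G : Graph) (v p : Fin (n G)) → Dec (∃ λ w → Edge G v w × w ≢ p)
neighbourBesides? G v p = any? (λ w → T? (adj G v w) ×-dec ¬? (w ≟ p))

degree≤1⊎minDegree≥2 : (G : Graph) → ∃ (Degree≤1 G) ⊎ MinDegree≥2 G
degree≤1⊎minDegree≥2 G with all? (λ v → all? (neighbourBesides? G v))
... | yes branching = inj₂ branching
... | no ¬branching with ¬∀⟶∃¬ _ _ (λ v → all? (neighbourBesides? G v)) ¬branching
...   | v , ¬∀p with ¬∀⟶∃¬ _ _ (neighbourBesides? G v) ¬∀p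
...     | p , ¬∃w = inj₁ (v , p , λ w e → decidable-stable (w ≟ p) (λ w≢p → ¬∃w (w , e , w≢p)))

record NonBacktrackingWalk (G : Graph) : Set where
  field
    vertex      : ℕ → Fin (n G)
    step        : ∀ i → Edge G (vertex i) (vertex (suc i))
    noBacktrack : ∀ i → vertex (suc (suc i)) ≢ vertex i

module _ (G : Graph) where
  open NonBacktrackingWalk

  minDegree≥2⇒walk : MinDegree≥2 G → Fin (n G) → NonBacktrackingWalk G
  minDegree≥2⇒walk branch start = record
    { vertex      = proj₁ ∘ dart
    ; step        = λ { zero → proj₁ (proj₂ (branch start start))
                      ; (suc i) → proj₁ (proj₂ (next (dart i))) }
    ; noBacktrack = λ i → proj₂ (proj₂ (next (dart i)))
    }
    where
    next : (d : Fin (n G) × Fin (n G)) → ∃ λ w → Edge G (proj₂ d) w × w ≢ proj₁ d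
    next (u , v) = branch v u

    dart : ℕ → Fin (n G) × Fin (n G)
    dart zero    = start , proj₁ (branch start start)
    dart (suc i) = proj₂ (dart i) , proj₁ (next (dart i))

  drop : ℕ → NonBacktrackingWalk G → NonBacktrackingWalk G
  drop c W = record
    { vertex      = λ i → vertex W (i + c)
    ; step        = λ i → step W (i + c)
    ; noBacktrack = λ i → noBacktrack W (i + c)
    }

  closedWalk⇒cycle : (W : NonBacktrackingWalk G) (L : ℕ) → vertex W 0 ≡ vertex W (suc L) →
                     (∀ {p q} → p < q → q ≤ L → vertex W p ≢ vertex W q) → Cycle G
  closedWalk⇒cycle W zero closes _ =
    ⊥-elim (Edge-irrefl G (subst (λ u → Edge G u (vertex W 1)) closes (step W 0)))
  closedWalk⇒cycle W (suc zero) closes _ = ⊥-elim (noBacktrack W 0 (≡-sym closes))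
  closedWalk⇒cycle W (suc (suc len)) closes distinct = record
    { len   = len
    ; vtx   = vertex W ∘ toℕ
    ; inj   = vtx-injective
    ; step  = λ c → subst (λ i → Edge G (vertex W i) (vertex W (suc (toℕ c))))
                          (≡-sym (toℕ-inject₁ c)) (step W (toℕ c))
    ; close = subst₂ (λ i u → Edge G (vertex W i) u)
                     (≡-sym (toℕ-fromℕ _)) (≡-sym closes) (step W (suc (suc len)))
    }
    where
    vtx-injective : Injective _≡_ _≡_ (vertex W ∘ toℕ)
    vtx-injective {x} {y} eq with <-cmp (toℕ x) (toℕ y)
    ... | tri< x<y _ _ = ⊥-elim (distinct x<y (≤-pred (toℕ<n y)) eq)
    ... | tri≈ _ x≡y _ = toℕ-injective x≡y
    ... | tri> _ _ y<x = ⊥-elim (distinct y<x (≤-pred (toℕ<n x)) (≡-sym eq))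

RepeatsAt : ∀ {N} → (ℕ → Fin N) → ℕ → Set
RepeatsAt f q = ∃ λ (c : Fin q) → f (toℕ c) ≡ f q

module _ {N} (f : ℕ → Fin N) where

  repeatsAt : ∀ {p q} → p < q → f p ≡ f q → RepeatsAt f q
  repeatsAt p<q eq = fromℕ< p<q , trans (cong f (toℕ-fromℕ< p<q)) eq

  repeats? : ∀ q → Dec (RepeatsAt f q)
  repeats? q = any? (λ (c : Fin q) → f (toℕ c) ≟ f q)

  someRepetition : ¬ (∀ (q : Fin (suc N)) → ¬ RepeatsAt f (toℕ q))
  someRepetition none with pigeonhole (n<1+n N) (f ∘ toℕ)
  ... | i , j , i<j , eq = none j (repeatsAt i<j eq)

  firstRepetition : ∃ λ q → RepeatsAt f q × (∀ {p p'} → p < p' → p' < q → f p ≢ f p')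
  firstRepetition with ¬∀⟶∃¬-smallest (suc N) (λ q → ¬ RepeatsAt f (toℕ q)) (¬? ∘ repeats? ∘ toℕ) someRepetition
  ... | q , ¬¬repeats , before = toℕ q , decidable-stable (repeats? (toℕ q)) ¬¬repeats , distinct
    where
    distinct : ∀ {p p'} → p < p' → p' < toℕ q → f p ≢ f p'
    distinct p<p' p'<q eq = before (fromℕ< p'<q)
      (subst (RepeatsAt f) (≡-sym (trans (toℕ-inject (fromℕ< p'<q)) (toℕ-fromℕ< p'<q))) (repeatsAt p<p' eq))

walk⇒cycle : {G : Graph} → NonBacktrackingWalk G → Cycle G
walk⇒cycle {G} W with firstRepetition (NonBacktrackingWalk.vertex W)
... | q , (c , repeat) , distinct with m≤n⇒∃[o]m+o≡n (toℕ<n c)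
...   | L , c+1+L≡q = closedWalk⇒cycle G (drop G (toℕ c) W) L
                        (trans repeat (cong (vertex W) (≡-sym q≡))) shifted-distinct
  where
  open NonBacktrackingWalk using (vertex)

  q≡ : suc L + toℕ c ≡ q
  q≡ = trans (cong suc (+-comm L (toℕ c))) c+1+L≡q

  shifted-distinct : ∀ {p p'} → p < p' → p' ≤ L → vertex W (p + toℕ c) ≢ vertex W (p' + toℕ c)
  shifted-distinct {p' = p'} p<p' p'≤L = distinct (+-monoˡ-< (toℕ c) p<p')
    (subst (λ r → p' + toℕ c < r) q≡ (s≤s (+-monoˡ-≤ (toℕ c) p'≤L)))

forest⇒degree≤1 : (G : Graph) → Forest G → Fin (n G) → ∃ (Degree≤1 G)
forest⇒degree≤1 G forest start =
  [ id , (λ branch → ⊥-elim (forest (walk⇒cycle (minDegree≥2⇒walk G branch start)))) ]′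
  (degree≤1⊎minDegree≥2 G)

-- Matching refl against n G ≡ m makes the vertex set of G definitionally Fin m.
forest⇒zykovEmbedding : ∀ m (G : Graph) → n G ≡ m → Forest G → ∃ λ k → Embedding (Edge G) (ZAdj {k})
forest⇒zykovEmbedding zero G refl _ =
  0 , record { map = λ () ; injective = λ { {()} } ; preserves = λ { {()} } ; reflects = λ { {()} } }
forest⇒zykovEmbedding (suc m) G refl forest = attachLeaf (forest⇒degree≤1 G forest zero)
  where
  attachLeaf : ∃ (Degree≤1 G) → ∃ λ k → Embedding (Edge G) (ZAdj {k})
  attachLeaf (v , p , onlyP) =
    attach (forest⇒zykovEmbedding m (induced G (punchIn v)) refl
              (induced-forest G (λ {x} {y} → punchIn-injective v x y) forest))
           (T? (adj G v p))
    where
    extendAt : ∀ {k} {f : Embedding (Edge (induced G (punchIn v))) (ZAdj {k})} →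
               FreshVertex f (Edge G v ∘ punchIn v) → Embedding (Edge G) (ZAdj {k})
    extendAt = extend (Edge-sym G) ZAdj-sym (Edge-irrefl G) ZAdj-irrefl v _

    attach : (∃ λ k → Embedding (Edge (induced G (punchIn v))) (ZAdj {k})) →
             Dec (Edge G v p) → ∃ λ k → Embedding (Edge G) (ZAdj {k})
    attach (k , f) (no v≁p) =
      suc (suc k) , extendAt (freshVertex-∘ f (freshIsolated k) isolated)
      where
      isolated : ∀ x → ⊥ ⇔ Edge G v (punchIn v x)
      isolated x = mk⇔ (λ ()) (λ e → v≁p (subst (Edge G v) (onlyP _ e) e))
    attach (k , f) (yes v~p) =
      suc k , extendAt (freshVertex-∘ f (freshPendant k (map f u)) pendant)
      where
      v≢p : v ≢ p
      v≢p refl = Edge-irrefl G v~p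

      u : Fin m
      u = punchOut v≢p

      pendant : ∀ x → map f x ≡ map f u ⇔ Edge G v (punchIn v x)
      pendant x = mk⇔
        (λ eq → subst (Edge G v) (≡-sym (trans (cong (punchIn v) (injective f eq)) (punchIn-punchOut v≢p))) v~p)
        (λ e → cong (map f) (punchIn-injective v x u (trans (onlyP _ e) (≡-sym (punchIn-punchOut v≢p)))))

lemma6 : (G : Graph) → Forest G → ZykovGraph G
lemma6 G forest with forest⇒zykovEmbedding (n G) G refl forest
... | k , f = k , map f , injective f , λ u v → preserves f , reflects f
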